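{- Let $m\ge 3$, $n\ge 1$ and let $\Sigma$ be a signature on the Book graph $B(m,n)$. Then, up to switching, $\Sigma$ is either the empty signature or a signature all of whose edges are incident to the vertex $u$. Moreover, $\Sigma$ is switching equivalent to such a signature (empty, or with all edges incident to $u$) of size at most $\lceil n/2\rceil$.
   Context: For integers $m\ge 3$, $n\ge 1$, the Book graph $B(m,n)$ is the simple graph with vertex set $\{u,v\}\cup\{u_j^l : 1\le l\le n,\ 1\le j\le m-2\}$ consisting of the $n$ cycles $C_m^l = u\,u_1^l\,u_2^l\cdots u_{m-2}^l\,v\,u$ ($l=1,\dots,n$), which pairwise share exactly the edge $uv$. A signature on a graph is a subset of its edges (the negative edges). Switching at a vertex $x$ changes the sign of every edge incident to $x$; two signatures are switching equivalent if one is obtained from the other by a sequence of switchings. The size of a signature is its number of edges. -}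

module Defs where

open import Data.Nat using (ℕ; zero; suc; _∸_; _<?_; _≤_)
open import Data.Nat.Properties using () 
open import Data.Fin using (Fin; toℕ; fromℕ<)
import Data.Fin.Properties as FinP
open import Data.Bool using (Bool; true; false; _xor_; _∨_)
open import Data.Product using (_×_; _,_; proj₁; proj₂; ∃)
open import Data.List using (List; []; _∷_; length; filter; concatMap; map)
open import Data.List using () renaming (_++_ to _++L_)
open import Data.Fin using () renaming (_≟_ to _≟F_)
open import Relation.Nullary using (Dec; yes; no; ¬_)
open import Relation.Nullary.Decidable using (⌊_⌋)
open import Relation.Binary.PropositionalEquality using (_≡_; refl; cong; cong₂)
open import Relation.Binary.Construct.Closure.ReflexiveTransitive using (Star)
open import Data.Sum using (_⊎_)
import Data.List.Base as LB

-- Vertices of the Book graph B(m,n):  u, v, and u_j^l  (l : Fin n, j : Fin (m ∸ 2)),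
-- where  inner l j  stands for  u_{j+1}^{l+1}  (0-based indices).
data Vertex (m n : ℕ) : Set where
  u v   : Vertex m n
  inner : Fin n → Fin (m ∸ 2) → Vertex m n

_≟V_ : ∀ {m n} (x y : Vertex m n) → Dec (x ≡ y)
u ≟V u = yes refl
u ≟V v = no λ ()
u ≟V inner _ _ = no λ ()
v ≟V u = no λ ()
v ≟V v = yes refl
v ≟V inner _ _ = no λ ()
inner _ _ ≟V u = no λ ()
inner _ _ ≟V v = no λ ()
inner l j ≟V inner l' j' with l ≟F l' | j ≟F j'
... | yes refl | yes refl = yes refl
... | no p     | _        = no λ { refl → p refl }
... | yes _    | no q     = no λ { refl → q refl }

-- Position k (0 ≤ k ≤ m-1) along the l-th cycle path  u = pos 0, u_1^l, …, u_{m-2}^l, v = pos (m-1).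
pathVertex : ∀ {m n} → Fin n → ℕ → Vertex m n
pathVertex {m} l zero = u
pathVertex {m} l (suc k) with k <? (m ∸ 2)
... | yes p = inner l (fromℕ< p)
... | no _  = v

data Edge (m n : ℕ) : Set where
  uv  : Edge m n
  cyc : Fin n → Fin (m ∸ 1) → Edge m n

ends : ∀ {m n} → Edge m n → Vertex m n × Vertex m n
ends uv        = u , v
ends (cyc l i) = pathVertex l (toℕ i) , pathVertex l (suc (toℕ i))

IncidentTo : ∀ {m n} → Vertex m n → Edge m n → Set
IncidentTo x e = x ≡ proj₁ (ends e) ⊎ x ≡ proj₂ (ends e)

incident? : ∀ {m n} → Vertex m n → Edge m n → Bool
incident? x e = ⌊ x ≟V proj₁ (ends e) ⌋ ∨ ⌊ x ≟V proj₂ (ends e) ⌋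

allEdges : ∀ m n → List (Edge m n)
allEdges m n = uv ∷ concatMap (λ l → map (cyc l) (LB.allFin (m ∸ 1))) (LB.allFin n)

-- A signature: the characteristic function of the set of negative edges.
Signature : ℕ → ℕ → Set
Signature m n = Edge m n → Bool

size : ∀ {m n} → Signature m n → ℕ
size {m} {n} σ = length (LB.filterᵇ σ (allEdges m n))

switch : ∀ {m n} → Vertex m n → Signature m n → Signature m n
switch x σ e = σ e xor incident? x e

SwitchStep : ∀ {m n} → Signature m n → Signature m n → Set
SwitchStep σ τ = ∃ λ x → ∀ e → τ e ≡ switch x σ e

SwitchEquiv : ∀ {m n} → Signature m n → Signature m n → Set
SwitchEquiv = Star SwitchStep

IsEmpty : ∀ {m n} → Signature m n → Set
IsEmpty σ = ∀ e → σ e ≡ false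

AllIncidentToU : ∀ {m n} → Signature m n → Set
AllIncidentToU σ = ∀ e → σ e ≡ true → IncidentTo u e

module Submission where

-- Switching at a set X of vertices changes the sign of an edge ab by
-- [a ∈ X] xor [b ∈ X].  So a signature σ can be switched by an arbitrary
-- "potential" f : V → Bool (the indicator of X); we show first that every
-- potential is realised by a sequence of single-vertex switchings.  Choosing
-- the potential of a vertex on page l to be the sign of the path from it to v
-- (plus σ(uv)), and an arbitrary value a at u, makes every page edge not
-- incident to u positive, gives uv the sign a, and gives the first edge u u₁ˡ
-- of page l the sign a xor sign(C_mˡ).  The resulting "reduced" signature has
-- all negative edges at u and has  [a] + #{l | a xor sign(C_mˡ)}  of them;
-- since the two counts for a = false and a = true add up to n + 1, one of the
-- two choices of a gives at most ⌈n/2⌉ negative edges.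

open import Defs
open import Data.Nat using (ℕ; zero; suc; _≤_; _<_; _<?_; _≤?_; _∸_; _+_; s≤s; z≤n; ⌈_/2⌉; ⌊_/2⌋)
open import Data.Nat.Properties
  using (≤-trans; ≤-reflexive; ≤-antisym; ≮⇒≥; ≰⇒>; +-comm; +-suc; +-identityʳ;
         +-∸-assoc; n∸n≡0; <⇒≤; +-monoʳ-<; +-cancelʳ-<; ⌊n/2⌋≤⌈n/2⌉; ⌊n/2⌋+⌈n/2⌉≡n;
         1+n≢n; module ≤-Reasoning)
open import Function using (_∘_)
open import Data.Fin using (Fin; toℕ; fromℕ<)
import Data.Fin as F
open import Data.Fin.Properties using (toℕ-fromℕ<; fromℕ<-toℕ; toℕ<n)
open import Data.Bool using (Bool; true; false; _xor_; _∧_; not; if_then_else_)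
open import Data.Bool.Properties
  using (xor-∧-commutativeRing; xor-assoc; xor-comm; xor-same; xor-identityʳ; ∧-zeroʳ; ∧-identityʳ)
open import Algebra.Bundles using (CommutativeRing)
open import Algebra.Properties.CommutativeSemigroup
  (CommutativeRing.+-commutativeSemigroup xor-∧-commutativeRing)
  using (interchange; x∙yz≈y∙xz)
open import Data.Product using (Σ; _×_; _,_; proj₁; proj₂)
open import Data.Sum using (_⊎_; inj₁; inj₂)
open import Data.List using (List; []; _∷_; length; concatMap; map; _++_; filterᵇ; allFin; tabulate)
open import Data.List.Properties using (filter-++; length-++; map-tabulate; length-tabulate)
open import Data.List.Relation.Unary.Any using (here; there)
import Data.List.Relation.Unary.Any as Any
open import Data.List.Membership.Propositional using (_∈_)
open import Data.List.Membership.Propositional.Properties using (∈-map⁺; ∈-concatMap⁺; ∈-allFin)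
open import Relation.Nullary using (yes; no; contradiction)
open import Relation.Nullary.Decidable using (⌊_⌋; T?)
open import Relation.Binary.PropositionalEquality
  using (_≡_; _≢_; refl; sym; trans; cong; cong₂; module ≡-Reasoning)
open import Relation.Binary.Construct.Closure.ReflexiveTransitive using (ε; _◅_; _◅◅_)

xor-cancelʳ : ∀ x y → (x xor y) xor y ≡ x
xor-cancelʳ x y = begin
  (x xor y) xor y ≡⟨ xor-assoc x y y ⟩
  x xor (y xor y) ≡⟨ cong (x xor_) (xor-same y) ⟩
  x xor false     ≡⟨ xor-identityʳ x ⟩
  x               ∎
  where open ≡-Reasoning

xor-cancelˡ : ∀ x y → x xor (y xor x) ≡ y
xor-cancelˡ x y = trans (xor-comm x (y xor x)) (xor-cancelʳ y x)

xor-offset : ∀ w x y → (w xor x) xor (w xor y) ≡ x xor y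
xor-offset w x y = begin
  (w xor x) xor (w xor y) ≡⟨ interchange w x w y ⟩
  (w xor w) xor (x xor y) ≡⟨ cong (_xor (x xor y)) (xor-same w) ⟩
  x xor y                 ∎
  where open ≡-Reasoning

bit : Bool → ℕ
bit b = if b then 1 else 0

count : ∀ {A : Set} → (A → Bool) → List A → ℕ
count p xs = length (filterᵇ p xs)

count-∷ : ∀ {A : Set} (p : A → Bool) x xs → count p (x ∷ xs) ≡ bit (p x) + count p xs
count-∷ p x xs with p x
... | true  = refl
... | false = refl

count-++ : ∀ {A : Set} (p : A → Bool) xs ys → count p (xs ++ ys) ≡ count p xs + count p ys
count-++ p xs ys = trans (cong length (filter-++ (T? ∘ p) xs ys)) (length-++ (filterᵇ p xs))

count-complement : ∀ {A : Set} (p : A → Bool) xs →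
                   count p xs + count (λ x → not (p x)) xs ≡ length xs
count-complement p [] = refl
count-complement p (x ∷ xs) with p x
... | true  = cong suc (count-complement p xs)
... | false = trans (+-suc (count p xs) _) (cong suc (count-complement p xs))

count-tabulate-none : ∀ {A : Set} {n} (p : A → Bool) (h : Fin n → A) →
                      (∀ i → p (h i) ≡ false) → count p (tabulate h) ≡ 0
count-tabulate-none {n = zero}  p h none = refl
count-tabulate-none {n = suc n} p h none
  rewrite count-∷ p (h F.zero) (tabulate (λ i → h (F.suc i))) | none F.zero
  = count-tabulate-none p (λ i → h (F.suc i)) (λ i → none (F.suc i))

balance : ∀ n K₀ K₁ → K₀ + K₁ ≡ n → K₀ ≤ ⌈ n /2⌉ ⊎ suc K₁ ≤ ⌈ n /2⌉
balance n K₀ K₁ sum with K₀ ≤? ⌈ n /2⌉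
... | yes small = inj₁ small
... | no large  = inj₂ (≤-trans (+-cancelʳ-< ⌈ n /2⌉ K₁ ⌊ n /2⌋ shifted) (⌊n/2⌋≤⌈n/2⌉ n))
  where
  open ≤-Reasoning
  shifted : K₁ + ⌈ n /2⌉ < ⌊ n /2⌋ + ⌈ n /2⌉
  shifted = begin-strict
    K₁ + ⌈ n /2⌉        <⟨ +-monoʳ-< K₁ (≰⇒> large) ⟩
    K₁ + K₀             ≡⟨ +-comm K₁ K₀ ⟩
    K₀ + K₁             ≡⟨ sum ⟩
    n                   ≡⟨ sym (⌊n/2⌋+⌈n/2⌉≡n n) ⟩
    ⌊ n /2⌋ + ⌈ n /2⌉   ∎

module Book (k n : ℕ) where

  V : Set
  V = Vertex (suc (suc k)) n

  E : Set
  E = Edge (suc (suc k)) n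

  Sig : Set
  Sig = Signature (suc (suc k)) n

  pathVertex-inner : ∀ l (j : Fin k) → pathVertex {suc (suc k)} {n} l (suc (toℕ j)) ≡ inner l j
  pathVertex-inner l j with toℕ j <? k
  ... | yes j<k = cong (inner l) (fromℕ<-toℕ j j<k)
  ... | no j≮k  = contradiction (toℕ<n j) j≮k

  pathVertex-index : ∀ l p {l′} {j : Fin k} →
                     pathVertex {suc (suc k)} {n} l (suc p) ≡ inner l′ j → toℕ j ≡ p
  pathVertex-index l p eq with p <? k | eq
  ... | yes p<k | refl = toℕ-fromℕ< p<k

  pathVertex-suc≢u : ∀ l p → pathVertex {suc (suc k)} {n} l (suc p) ≢ u
  pathVertex-suc≢u l p with p <? k
  ... | yes _ = λ ()
  ... | no _  = λ ()

  -- B(k+2, n) has no loops; this is what makes switching additive.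
  ends-distinct : ∀ (e : E) → proj₁ (ends e) ≢ proj₂ (ends e)
  ends-distinct uv ()
  ends-distinct (cyc l F.zero) eq = pathVertex-suc≢u l 0 (sym eq)
  ends-distinct (cyc l (F.suc i)) eq =
    1+n≢n (sym (pathVertex-index l (suc (toℕ i)) (trans (sym eq) (pathVertex-inner l i))))

  incident?-xor : ∀ x (e : E) →
                  incident? x e ≡ ⌊ x ≟V proj₁ (ends e) ⌋ xor ⌊ x ≟V proj₂ (ends e) ⌋
  incident?-xor x e with x ≟V proj₁ (ends e) | x ≟V proj₂ (ends e)
  ... | yes refl | yes same = contradiction same (ends-distinct e)
  ... | yes _    | no _     = refl
  ... | no _     | yes _    = refl
  ... | no _     | no _     = refl

  switchBy : (V → Bool) → Sig → Sig
  switchBy f σ e = σ e xor (f (proj₁ (ends e)) xor f (proj₂ (ends e)))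

  Realisable : (V → Bool) → Set
  Realisable f = ∀ σ τ → (∀ e → τ e ≡ switchBy f σ e) → SwitchEquiv σ τ

  realisable-resp : ∀ {f} g → (∀ y → f y ≡ g y) → Realisable f → Realisable g
  realisable-resp g f≗g rf σ τ τ≗ = rf σ τ λ e →
    trans (τ≗ e) (cong₂ (λ a b → σ e xor (a xor b)) (sym (f≗g _)) (sym (f≗g _)))

  realisable-zero : Realisable (λ _ → false)
  realisable-zero σ τ τ≗ = (u , λ e → refl) ◅ (u , back) ◅ ε
    where
    back : ∀ e → τ e ≡ switch u (switch u σ) e
    back e = trans (τ≗ e) (trans (xor-identityʳ (σ e)) (sym (xor-cancelʳ (σ e) (incident? u e))))

  realisable-flip : ∀ {f} → Realisable f → ∀ x → Realisable (λ y → f y xor ⌊ x ≟V y ⌋)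
  realisable-flip {f} rf x σ τ τ≗ = rf σ (switchBy f σ) (λ e → refl) ◅◅ ((x , last) ◅ ε)
    where
    last : ∀ e → τ e ≡ switch x (switchBy f σ) e
    last e = begin
      τ e                                    ≡⟨ τ≗ e ⟩
      σ e xor ((fa xor ia) xor (fb xor ib))  ≡⟨ cong (σ e xor_) (interchange fa ia fb ib) ⟩
      σ e xor ((fa xor fb) xor (ia xor ib))  ≡⟨ sym (xor-assoc (σ e) _ _) ⟩
      switchBy f σ e xor (ia xor ib)         ≡⟨ cong (switchBy f σ e xor_) (sym (incident?-xor x e)) ⟩
      switch x (switchBy f σ) e              ∎
      where
      open ≡-Reasoning
      fa fb ia ib : Bool
      fa = f (proj₁ (ends e))
      fb = f (proj₂ (ends e))
      ia = ⌊ x ≟V proj₁ (ends e) ⌋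
      ib = ⌊ x ≟V proj₂ (ends e) ⌋

  adjust : V → Bool → (V → Bool) → V → Bool
  adjust x b g y = g y xor (⌊ x ≟V y ⌋ ∧ b)

  realisable-adjust : ∀ x b {g} → Realisable g → Realisable (adjust x b g)
  realisable-adjust x false {g} rg =
    realisable-resp (adjust x false g)
      (λ y → sym (trans (cong (g y xor_) (∧-zeroʳ ⌊ x ≟V y ⌋)) (xor-identityʳ (g y)))) rg
  realisable-adjust x true {g} rg =
    realisable-resp (adjust x true g)
      (λ y → cong (g y xor_) (sym (∧-identityʳ ⌊ x ≟V y ⌋))) (realisable-flip {g} rg x)

  restrict : List V → (V → Bool) → V → Bool
  restrict []       f = λ _ → false
  restrict (x ∷ xs) f = adjust x (f x xor restrict xs f x) (restrict xs f)

  realisable-restrict : ∀ xs f → Realisable (restrict xs f)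
  realisable-restrict []       f = realisable-zero
  realisable-restrict (x ∷ xs) f =
    realisable-adjust x (f x xor restrict xs f x) {restrict xs f} (realisable-restrict xs f)

  restrict-agrees : ∀ xs f {y} → y ∈ xs → restrict xs f y ≡ f y
  restrict-agrees (x ∷ xs) f {y} y∈ with x ≟V y | y∈
  ... | yes refl | _         = xor-cancelˡ (restrict xs f x) (f x)
  ... | no x≢y   | here y≡x  = contradiction (sym y≡x) x≢y
  ... | no _     | there y∈′ = trans (xor-identityʳ _) (restrict-agrees xs f y∈′)

  vertices : List V
  vertices = u ∷ v ∷ concatMap (λ l → map (inner l) (allFin k)) (allFin n)

  vertices-complete : ∀ y → y ∈ vertices
  vertices-complete u           = here refl
  vertices-complete v           = there (here refl)
  vertices-complete (inner l j) = there (there (∈-concatMap⁺ (λ l′ → map (inner l′) (allFin k))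
    (Any.map (λ { refl → ∈-map⁺ (inner l) (∈-allFin j) }) (∈-allFin l))))

  realisable-all : ∀ f → Realisable f
  realisable-all f = realisable-resp f (λ y → restrict-agrees vertices f (vertices-complete y))
                                     (realisable-restrict vertices f)

  -- Sign of the p-th edge of page l (false beyond the last edge).
  edgeSign : Sig → Fin n → ℕ → Bool
  edgeSign σ l p with p <? suc k
  ... | yes p<k+1 = σ (cyc l (fromℕ< p<k+1))
  ... | no _      = false

  edgeSign-cyc : ∀ σ l (i : Fin (suc k)) → edgeSign σ l (toℕ i) ≡ σ (cyc l i)
  edgeSign-cyc σ l i with toℕ i <? suc k
  ... | yes i<k+1 = cong (λ j → σ (cyc l j)) (fromℕ<-toℕ i i<k+1)
  ... | no i≮k+1  = contradiction (toℕ<n i) i≮k+1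

  segment : (ℕ → Bool) → ℕ → ℕ → Bool
  segment s p zero    = false
  segment s p (suc d) = s p xor segment s (suc p) d

  pathSign : Sig → Fin n → ℕ → Bool
  pathSign σ l p = segment (edgeSign σ l) p (suc k ∸ p)

  pathSign-step : ∀ σ l p → p ≤ k → pathSign σ l p ≡ edgeSign σ l p xor pathSign σ l (suc p)
  pathSign-step σ l p p≤k = cong (segment (edgeSign σ l) p) (+-∸-assoc 1 p≤k)

  pathSign-end : ∀ σ l → pathSign σ l (suc k) ≡ false
  pathSign-end σ l = cong (segment (edgeSign σ l) (suc k)) (n∸n≡0 (suc k))

  -- The sign of the cycle C_mˡ, which switching cannot change.
  cycleSign : Sig → Fin n → Bool
  cycleSign σ l = σ uv xor pathSign σ l 0

  potential : Sig → Bool → V → Bool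
  potential σ a u           = a
  potential σ a v           = σ uv
  potential σ a (inner l j) = σ uv xor pathSign σ l (suc (toℕ j))

  potential-path : ∀ σ a l p → p ≤ k →
                   potential σ a (pathVertex l (suc p)) ≡ σ uv xor pathSign σ l (suc p)
  potential-path σ a l p p≤k with p <? k
  ... | yes p<k = cong (λ q → σ uv xor pathSign σ l (suc q)) (toℕ-fromℕ< p<k)
  ... | no p≮k  rewrite ≤-antisym p≤k (≮⇒≥ p≮k) | pathSign-end σ l = sym (xor-identityʳ (σ uv))

  reduced : Sig → Bool → Sig
  reduced σ a uv                = a
  reduced σ a (cyc l F.zero)    = a xor cycleSign σ l
  reduced σ a (cyc l (F.suc _)) = false

  potential-reduces : ∀ σ a e → switchBy (potential σ a) σ e ≡ reduced σ a e
  potential-reduces σ a uv = xor-cancelˡ (σ uv) a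
  potential-reduces σ a (cyc l F.zero) = begin
    s₀ xor (a xor potential σ a (pathVertex l 1))
      ≡⟨ cong (λ t → s₀ xor (a xor t)) (potential-path σ a l 0 z≤n) ⟩
    s₀ xor (a xor (σ uv xor pathSign σ l 1))
      ≡⟨ x∙yz≈y∙xz s₀ a _ ⟩
    a xor (s₀ xor (σ uv xor pathSign σ l 1))
      ≡⟨ cong (a xor_) (x∙yz≈y∙xz s₀ (σ uv) _) ⟩
    a xor (σ uv xor (s₀ xor pathSign σ l 1))
      ≡⟨ cong (λ t → a xor (σ uv xor (t xor pathSign σ l 1))) (sym (edgeSign-cyc σ l F.zero)) ⟩
    a xor (σ uv xor (edgeSign σ l 0 xor pathSign σ l 1))
      ≡⟨ cong (λ t → a xor (σ uv xor t)) (sym (pathSign-step σ l 0 z≤n)) ⟩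
    a xor cycleSign σ l
      ∎
    where
    open ≡-Reasoning
    s₀ : Bool
    s₀ = σ (cyc l F.zero)
  potential-reduces σ a (cyc l (F.suc i)) = begin
    s xor (potential σ a (pathVertex l (suc p)) xor potential σ a (pathVertex l (suc (suc p))))
      ≡⟨ cong₂ (λ x y → s xor (x xor y)) (potential-path σ a l p (<⇒≤ (toℕ<n i)))
                                         (potential-path σ a l (suc p) (toℕ<n i)) ⟩
    s xor ((σ uv xor pathSign σ l (suc p)) xor (σ uv xor pathSign σ l (suc (suc p))))
      ≡⟨ cong (s xor_) (xor-offset (σ uv) _ _) ⟩
    s xor (pathSign σ l (suc p) xor pathSign σ l (suc (suc p)))
      ≡⟨ cong (λ t → s xor (t xor pathSign σ l (suc (suc p)))) (pathSign-step σ l (suc p) (toℕ<n i)) ⟩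
    s xor ((edgeSign σ l (suc p) xor pathSign σ l (suc (suc p))) xor pathSign σ l (suc (suc p)))
      ≡⟨ cong (s xor_) (xor-cancelʳ _ _) ⟩
    s xor edgeSign σ l (suc p)
      ≡⟨ cong (s xor_) (edgeSign-cyc σ l (F.suc i)) ⟩
    s xor s
      ≡⟨ xor-same s ⟩
    false ∎
    where
    open ≡-Reasoning
    s : Bool
    s = σ (cyc l (F.suc i))
    p : ℕ
    p = toℕ i

  reduce : ∀ σ a → SwitchEquiv σ (reduced σ a)
  reduce σ a = realisable-all (potential σ a) σ (reduced σ a) (λ e → sym (potential-reduces σ a e))

  reduced-at-u : ∀ σ a → AllIncidentToU (reduced σ a)
  reduced-at-u σ a uv                _  = inj₁ refl
  reduced-at-u σ a (cyc l F.zero)    _  = inj₁ refl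
  reduced-at-u σ a (cyc l (F.suc _)) ()

  size-reduced : ∀ σ a → size (reduced σ a) ≡ bit a + count (λ l → a xor cycleSign σ l) (allFin n)
  size-reduced σ a = trans (count-∷ τ uv _) (cong (bit a +_) (pages (allFin n)))
    where
    τ : Sig
    τ = reduced σ a
    b : Fin n → Bool
    b l = a xor cycleSign σ l
    page : Fin n → List E
    page l = map (cyc l) (allFin (suc k))
    page-count : ∀ l → count τ (page l) ≡ bit (b l)
    page-count l = begin
      count τ (page l)
        ≡⟨ count-∷ τ (cyc l F.zero) _ ⟩
      bit (b l) + count τ (map (cyc l) (tabulate F.suc))
        ≡⟨ cong (λ xs → bit (b l) + count τ xs) (map-tabulate F.suc (cyc l)) ⟩
      bit (b l) + count τ (tabulate (λ i → cyc l (F.suc i)))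
        ≡⟨ cong (bit (b l) +_) (count-tabulate-none τ (λ i → cyc l (F.suc i)) (λ i → refl)) ⟩
      bit (b l) + 0
        ≡⟨ +-identityʳ _ ⟩
      bit (b l)
        ∎
      where open ≡-Reasoning
    pages : ∀ ls → count τ (concatMap page ls) ≡ count b ls
    pages []       = refl
    pages (l ∷ ls) = trans (count-++ τ (page l) (concatMap page ls))
                           (trans (cong₂ _+_ (page-count l) (pages ls)) (sym (count-∷ b l ls)))

  small-reduction : ∀ σ → Σ Bool (λ a → size (reduced σ a) ≤ ⌈ n /2⌉)
  small-reduction σ
    with balance n (count (cycleSign σ) (allFin n)) (count (not ∘ cycleSign σ) (allFin n))
                   (trans (count-complement (cycleSign σ) (allFin n)) (length-tabulate (λ i → i)))
  ... | inj₁ few = false , ≤-trans (≤-reflexive (size-reduced σ false)) few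
  ... | inj₂ few = true  , ≤-trans (≤-reflexive (size-reduced σ true)) few

  switching-reduction : ∀ σ → Σ Sig (λ τ →
    SwitchEquiv σ τ × (IsEmpty τ ⊎ AllIncidentToU τ) × size τ ≤ ⌈ n /2⌉)
  switching-reduction σ with small-reduction σ
  ... | a , small = reduced σ a , reduce σ a , inj₂ (reduced-at-u σ a) , small

-- The Book module covers every m = k + 2 ≥ 2 and every n, so only m ≥ 3 is used here.
proposition4p1 : (m n : ℕ) → 3 ≤ m → 1 ≤ n → (σ : Signature m n) →
    Σ (Signature m n) (λ τ →
    SwitchEquiv σ τ × (IsEmpty τ ⊎ AllIncidentToU τ) × size τ ≤ ⌈ n /2⌉)
proposition4p1 (suc (suc (suc k))) n (s≤s (s≤s (s≤s _))) _ = Book.switching-reduction (suc k) n
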